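{- Let $N=p_1p_2\cdots p_m$ be a squarefree composite positive integer with primes $p_1<p_2<\dots<p_m$ ($m\ge 2$). For $k\in\mathbb{Z}\setminus\{ -1\}$ and a prime $p\mid N$ put $M(k,p)=\frac{N+kp}{k+1}$. (1) If the set of positive elements of $\mathbb{Q}\text{ - }\mathcal{KS}(N)$ is nonempty, write it as $\{\gamma_1,\dots,\gamma_r\}$ with $0<\gamma_1<\dots<\gamma_r$. Then $\gamma_i\le M(j+r-i,p_j)$ for every $(i,j)\in\{1,\dots,r\}\times\{1,\dots,m\}$. (2) If the set of negative elements of $\mathbb{Q}\text{ - }\mathcal{KS}(N)$ is nonempty, write it as $\{\beta_1,\dots,\beta_t\}$ with $\beta_1<\dots<\beta_t<0$. Then $M(j-m-s-2,p_j)\le\beta_s$ for every $(s,j)\in\{1,\dots,t\}\times\{1,\dots,m\}$.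
   Context: For a positive integer $N\ge 2$, the $\mathbb{Q}$-Korselt set $\mathbb{Q}\text{ - }\mathcal{KS}(N)$ is the set of all rationals $\alpha=\frac{\alpha_1}{\alpha_2}\in\mathbb{Q}\setminus\{0,N\}$ (written with $\alpha_1\in\mathbb{Z}$, $\alpha_2>0$, $\gcd(\alpha_1,\alpha_2)=1$) such that the integer $\alpha_2p-\alpha_1$ divides the integer $\alpha_2N-\alpha_1$ for every prime divisor $p$ of $N$. -}

module Defs where

open import Data.Nat as ℕ using (ℕ; zero; suc)
open import Data.Nat.Divisibility as ℕD using ()
open import Data.Nat.Primality using (Prime)
open import Data.Integer as ℤ using (ℤ; +_; -[1+_])
open import Data.Integer.Divisibility as ℤD using ()
open import Data.Rational as ℚ using (ℚ; ↥_; ↧_; 0ℚ)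
open import Data.Fin using (Fin; zero; suc)
open import Data.Product using (_×_)
open import Relation.Binary.PropositionalEquality using (_≡_; _≢_)

prodF : ∀ {m} → (Fin m → ℕ) → ℕ
prodF {zero}  p = 1
prodF {suc m} p = p zero ℕ.* prodF (λ i → p (suc i))

-- α = ↥α / ↧α in lowest terms with ↧α > 0 (ℚ is normalised).
-- α ∈ Q-KS(N):  α ∉ {0, N} and (α₂ p − α₁) ∣ (α₂ N − α₁) for every prime p ∣ N.
QKS : ℕ → ℚ → Set
QKS N α =
  (α ≢ 0ℚ) × (α ≢ (+ N ℚ./ 1)) ×
  (∀ (p : ℕ) → Prime p → p ℕD.∣ N →
     ((↧ α) ℤ.* (+ p) ℤ.- (↥ α)) ℤD.∣ ((↧ α) ℤ.* (+ N) ℤ.- (↥ α)))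

-- M(k,p) = (N + k p)/(k + 1); the value at k = -1 is a junk 0 (never used).
M : ℕ → ℤ → ℕ → ℚ
M N k p with k ℤ.+ ℤ.1ℤ
... | + zero    = 0ℚ
... | + suc n   = (+ N ℤ.+ k ℤ.* + p) ℚ./ suc n
... | -[1+ n ]  = (ℤ.- (+ N ℤ.+ k ℤ.* + p)) ℚ./ suc n

-- For a Korselt rational α = a/b and a prime p ∣ N, the Korselt quotient
-- q(α, p) = (bN − a)/(bp − a) = (N − α)/(p − α) is an integer.  On each side of the pole
-- α = p it is strictly increasing in α and, for α < N, strictly decreasing in p; and
-- α(k + 1) ≤ N + kp holds as soon as (q + k)(bp − a) ≥ 0.
-- If γᵢ > pⱼ, every quotient met on the way from (γᵣ, p₁) to (γᵢ, pⱼ) is negative and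
-- q(γᵣ, p₁) ≤ −1, so q(γᵢ, pⱼ) ≤ −(j + r − i), which is γᵢ ≤ M(j + r − i, pⱼ); if γᵢ ≤ pⱼ the
-- bound is immediate.  For negative β all quotients are positive and q(β₁, pₘ) ≥ 3: it exceeds 1,
-- and q = 2 would force β₁ = 2pₘ − N, which the Korselt condition at p₁ rules out.  Walking
-- from (β₁, pₘ) to (βₛ, pⱼ) gives q(βₛ, pⱼ) ≥ m − j + s + 2, which is M(j − m − s − 2, pⱼ) ≤ βₛ.
module Submission where

open import Data.Nat.Base as ℕ using (ℕ)
open import Data.Fin.Base as Fin using (Fin)
open import Data.Nat.Primality using (Prime)

module Integers where

  open import Data.Integer.Base
  open import Data.Integer.Properties
  open import Data.Integer.Tactic.RingSolver using (solve-∀)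
  open import Relation.Binary.PropositionalEquality

  i<j⇒0<j-i : ∀ {i j} → i < j → 0ℤ < j - i
  i<j⇒0<j-i {i} {j} i<j = subst (_< j - i) (+-inverseʳ i) (+-monoˡ-< (- i) i<j)

  i<j⇒i-j<0 : ∀ {i j} → i < j → i - j < 0ℤ
  i<j⇒i-j<0 {i} {j} i<j = subst (i - j <_) (+-inverseʳ j) (+-monoˡ-< (- j) i<j)

  i<i+j : ∀ i {j} → 0ℤ < j → i < i + j
  i<i+j i {j} 0<j = subst (_< i + j) (+-identityʳ i) (+-monoʳ-< i 0<j)

  +[m+n]-+n≡+m : ∀ m n → + (m ℕ.+ n) - + n ≡ + m
  +[m+n]-+n≡+m m n = trans (cong (_- + n) (pos-+ m n)) (cancel (+ m) (+ n))
    where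
    cancel : ∀ x y → x + y - y ≡ x
    cancel = solve-∀

  +m-+[m+n]≡-+n : ∀ m n → + m - + (m ℕ.+ n) ≡ - + n
  +m-+[m+n]≡-+n m n = trans (cong (λ t → + m - t) (pos-+ m n)) (cancel (+ m) (+ n))
    where
    cancel : ∀ x y → x - (x + y) ≡ - y
    cancel = solve-∀

  -i*-j≡i*j : ∀ i j → - i * - j ≡ i * j
  -i*-j≡i*j = solve-∀

  pos*pos⇒pos : ∀ {i j} → 0ℤ < i → 0ℤ < j → 0ℤ < i * j
  pos*pos⇒pos {i} {j} 0<i 0<j =
    subst (_< i * j) (*-zeroˡ j) (*-monoʳ-<-pos j {{positive 0<j}} 0<i)

  neg*neg⇒pos : ∀ {i j} → i < 0ℤ → j < 0ℤ → 0ℤ < i * j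
  neg*neg⇒pos {i} {j} i<0 j<0 =
    subst (0ℤ <_) (-i*-j≡i*j i j) (pos*pos⇒pos (neg-mono-< i<0) (neg-mono-< j<0))

  nonNeg*nonNeg⇒nonNeg : ∀ {i j} → 0ℤ ≤ i → 0ℤ ≤ j → 0ℤ ≤ i * j
  nonNeg*nonNeg⇒nonNeg {i} {j} 0≤i 0≤j =
    subst (_≤ i * j) (*-zeroˡ j) (*-monoʳ-≤-nonNeg j {{nonNegative 0≤j}} 0≤i)

  nonPos*nonPos⇒nonNeg : ∀ {i j} → i ≤ 0ℤ → j ≤ 0ℤ → 0ℤ ≤ i * j
  nonPos*nonPos⇒nonNeg {i} {j} i≤0 j≤0 =
    subst (0ℤ ≤_) (-i*-j≡i*j i j) (nonNeg*nonNeg⇒nonNeg (neg-mono-≤ i≤0) (neg-mono-≤ j≤0))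

  ≤-chain-<0 : ∀ {x y z} a b → x + + a ≤ y → y + + b ≤ z → z < 0ℤ → x + + ℕ.suc (a ℕ.+ b) ≤ 0ℤ
  ≤-chain-<0 {x} {y} {z} a b x+a≤y y+b≤z z<0 = begin
    x + + ℕ.suc (a ℕ.+ b)  ≡⟨ regroup x (+ a) (+ b) ⟩
    1ℤ + (x + + a + + b)   ≤⟨ +-monoʳ-≤ 1ℤ (+-monoˡ-≤ (+ b) x+a≤y) ⟩
    1ℤ + (y + + b)         ≤⟨ +-monoʳ-≤ 1ℤ y+b≤z ⟩
    1ℤ + z                 ≤⟨ i<j⇒suc[i]≤j z<0 ⟩
    0ℤ                     ∎
    where
    open ≤-Reasoning
    regroup : ∀ x a b → x + (1ℤ + (a + b)) ≡ 1ℤ + (x + a + b)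
    regroup = solve-∀

  ≤-chain->2 : ∀ {x y z} a b → z + + b ≤ y → y + + a ≤ x → + 2 < z → 0ℤ ≤ x - + (3 ℕ.+ (a ℕ.+ b))
  ≤-chain->2 {x} {y} {z} a b z+b≤y y+a≤x 2<z = i≤j⇒0≤j-i (begin
    + 3 + (+ a + + b)      ≡⟨ regroup (+ 3) (+ a) (+ b) ⟩
    + 3 + + b + + a        ≤⟨ +-monoˡ-≤ (+ a) (+-monoˡ-≤ (+ b) (i<j⇒suc[i]≤j 2<z)) ⟩
    z + + b + + a          ≤⟨ +-monoˡ-≤ (+ a) z+b≤y ⟩
    y + + a                ≤⟨ y+a≤x ⟩
    x                      ∎)
    where
    open ≤-Reasoning
    regroup : ∀ c a b → c + (a + b) ≡ c + b + a
    regroup = solve-∀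

  pos-quotient : ∀ {q d k} → q * d ≡ k → 0ℤ < d → 0ℤ < k → 0ℤ < q
  pos-quotient {q} {d} refl 0<d 0<qd =
    *-cancelʳ-<-nonNeg d {{nonNegative (<⇒≤ 0<d)}} (subst (_< q * d) (sym (*-zeroˡ d)) 0<qd)

  pos-quotient⇒≤ : ∀ {q d k} → q * d ≡ k → 0ℤ < d → 0ℤ < k → d ≤ k
  pos-quotient⇒≤ {q} {d} refl 0<d 0<qd =
    subst (_≤ q * d) (*-identityˡ d)
      (*-monoʳ-≤-nonNeg d {{nonNegative (<⇒≤ 0<d)}} (i<j⇒suc[i]≤j (pos-quotient {q} refl 0<d 0<qd)))

  quotient>1 : ∀ {q d k} → q * d ≡ k → 0ℤ < d → d < k → 1ℤ < q
  quotient>1 {q} {d} refl 0<d d<qd =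
    *-cancelʳ-<-nonNeg {1ℤ} {q} d {{nonNegative (<⇒≤ 0<d)}} (subst (_< q * d) (sym (*-identityˡ d)) d<qd)

  quotient≡1 : ∀ {q d k} → q * d ≡ k → 0ℤ < d → 0ℤ < k → k < d + d → q ≡ 1ℤ
  quotient≡1 {q} {d} refl 0<d 0<qd qd<2d = unit (pos-quotient {q} refl 0<d 0<qd) q<2
    where
    d+d≡2*d : ∀ d → d + d ≡ + 2 * d
    d+d≡2*d = solve-∀
    q<2 : q < + 2
    q<2 = *-cancelʳ-<-nonNeg d {{nonNegative (<⇒≤ 0<d)}} (subst (q * d <_) (d+d≡2*d d) qd<2d)
    unit : ∀ {q} → 0ℤ < q → q < + 2 → q ≡ 1ℤ
    unit {+0}               (+<+ ()) _
    unit {+[1+ 0 ]}         _        _ = refl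
    unit {+[1+ ℕ.suc n ]}   _        (+<+ (ℕ.s≤s (ℕ.s≤s ())))

  quotient-< : ∀ {q d k q′ d′ k′} → q * d ≡ k → q′ * d′ ≡ k′ →
               0ℤ < d * d′ → k * d′ < k′ * d → q < q′
  quotient-< {q} {d} {_} {q′} {d′} refl refl 0<dd′ kd′<k′d =
    *-cancelʳ-<-nonNeg (d * d′) {{nonNegative (<⇒≤ 0<dd′)}} (subst₂ _<_ (lhs q d d′) (rhs q′ d d′) kd′<k′d)
    where
    lhs : ∀ q d d′ → q * d * d′ ≡ q * (d * d′)
    lhs = solve-∀
    rhs : ∀ q′ d d′ → q′ * d′ * d ≡ q′ * (d * d′)
    rhs = solve-∀

module FinGaps where

  open import Data.Nat.Base using (zero; suc; _∸_)
  import Data.Nat.Properties as ℕ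
  open import Data.Fin.Base using (toℕ; fromℕ<)
  open import Data.Fin.Properties using (toℕ-fromℕ<; toℕ-injective; toℕ<n)
  open import Data.Integer.Base using (ℤ; +_; 1ℤ; _+_; -_; _≤_; _<_)
  open import Data.Integer.Properties
  open import Data.Integer.Tactic.RingSolver using (solve-∀)
  open import Data.Sum using (_⊎_; inj₁; inj₂; [_,_]′)
  open import Relation.Binary.PropositionalEquality

  ≤⇒≡∨< : ∀ {n} {i j : Fin n} → i Fin.≤ j → i ≡ j ⊎ i Fin.< j
  ≤⇒≡∨< i≤j = [ inj₂ , (λ i≡j → inj₁ (toℕ-injective i≡j)) ]′ (ℕ.m≤n⇒m<n∨m≡n i≤j)

  gap-ascending : ∀ {n} (f : Fin n → ℤ) {i j} → i Fin.≤ j →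
                  (∀ {k l} → i Fin.≤ k → k Fin.< l → l Fin.≤ j → f k < f l) →
                  f i + + (toℕ j ∸ toℕ i) ≤ f j
  gap-ascending {n} f {i} {j} i≤j ascending = go (toℕ j ∸ toℕ i) (ℕ.m+[n∸m]≡n i≤j) ascending
    where
    open ≤-Reasoning
    shift : ∀ x y → x + (1ℤ + y) ≡ 1ℤ + x + y
    shift = solve-∀
    go : ∀ d {i} → toℕ i ℕ.+ d ≡ toℕ j → (∀ {k l} → i Fin.≤ k → k Fin.< l → l Fin.≤ j → f k < f l) →
         f i + + d ≤ f j
    go zero {i} i+0≡j _ =
      ≤-reflexive (trans (+-identityʳ (f i)) (cong f (toℕ-injective (trans (sym (ℕ.+-identityʳ (toℕ i))) i+0≡j))))
    go (suc d) {i} i+d≡j ascending′ = begin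
      f i + + suc d     ≡⟨ shift (f i) (+ d) ⟩
      1ℤ + f i + + d    ≤⟨ +-monoˡ-≤ (+ d) (i<j⇒suc[i]≤j (ascending′ ℕ.≤-refl i<i′ i′≤j)) ⟩
      f i′ + + d        ≤⟨ go d i′+d≡j (λ i′≤k → ascending′ (ℕ.<⇒≤ (ℕ.<-≤-trans i<i′ i′≤k))) ⟩
      f j               ∎
      where
      1+i≤j : suc (toℕ i) ℕ.≤ toℕ j
      1+i≤j = subst (suc (toℕ i) ℕ.≤_) (trans (sym (ℕ.+-suc (toℕ i) d)) i+d≡j) (ℕ.m≤m+n (suc (toℕ i)) d)
      i′ : Fin n
      i′ = fromℕ< (ℕ.≤-<-trans 1+i≤j (toℕ<n j))
      toℕi′ : toℕ i′ ≡ suc (toℕ i)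
      toℕi′ = toℕ-fromℕ< (ℕ.≤-<-trans 1+i≤j (toℕ<n j))
      i<i′ : i Fin.< i′
      i<i′ = ℕ.≤-reflexive (sym toℕi′)
      i′≤j : i′ Fin.≤ j
      i′≤j = subst (ℕ._≤ toℕ j) (sym toℕi′) 1+i≤j
      i′+d≡j : toℕ i′ ℕ.+ d ≡ toℕ j
      i′+d≡j = trans (cong (ℕ._+ d) toℕi′) (trans (sym (ℕ.+-suc (toℕ i) d)) i+d≡j)

  gap-descending : ∀ {n} (f : Fin n → ℤ) {i j} → i Fin.≤ j →
                   (∀ {k l} → i Fin.≤ k → k Fin.< l → l Fin.≤ j → f l < f k) →
                   f j + + (toℕ j ∸ toℕ i) ≤ f i
  gap-descending f {i} {j} i≤j descending =
    subst₂ _≤_ (swapˡ (f i) (f j) (+ (toℕ j ∸ toℕ i))) (swapʳ (f i) (f j))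
      (+-monoˡ-≤ (f i + f j) (gap-ascending (λ k → - f k) i≤j λ i≤k k<l l≤j → neg-mono-< (descending i≤k k<l l≤j)))
    where
    swapˡ : ∀ x y d → - x + d + (x + y) ≡ y + d
    swapˡ = solve-∀
    swapʳ : ∀ x y → - y + (x + y) ≡ x
    swapʳ = solve-∀

module Products where

  open import Data.Nat.Base
  open import Data.Nat.Properties
  open import Data.Nat.Divisibility using (_∣_; m∣m*n; n∣m*n; ∣-trans; ∣⇒≤)
  open import Data.Fin.Base using (zero; suc)
  open import Data.Vec.Functional using (tail)
  open import Function.Base using (_∘_)
  open import Relation.Binary.PropositionalEquality
  open import Defs using (prodF)

  factor∣prodF : ∀ {m} (p : Fin m → ℕ) j → p j ∣ prodF p
  factor∣prodF p zero    = m∣m*n (prodF (tail p))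
  factor∣prodF p (suc j) = ∣-trans (factor∣prodF (tail p) j) (n∣m*n (p zero))

  prodF-pos : ∀ {m} (p : Fin m → ℕ) → (∀ j → 0 < p j) → 0 < prodF p
  prodF-pos {zero}  p _   = z<s
  prodF-pos {suc m} p pos = *-mono-< (pos zero) (prodF-pos (tail p) (pos ∘ suc))

  factor≤prodF : ∀ {m} (p : Fin m → ℕ) → (∀ j → 0 < p j) → ∀ j → p j ≤ prodF p
  factor≤prodF p pos j = ∣⇒≤ {{>-nonZero (prodF-pos p pos)}} (factor∣prodF p j)

  factor<prodF : ∀ {m} (p : Fin (2 + m) → ℕ) → (∀ j → 1 < p j) → ∀ j → p j < prodF p
  factor<prodF p 1<p zero    =
    m<m*n (p zero) (prodF (tail p)) {{>-nonZero (<⇒≤ (1<p zero))}}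
      (<-≤-trans (1<p (suc zero)) (factor≤prodF (tail p) (<⇒≤ ∘ 1<p ∘ suc) zero))
  factor<prodF p 1<p (suc j) =
    ≤-<-trans (factor≤prodF (tail p) (<⇒≤ ∘ 1<p ∘ suc) j)
      (subst (prodF (tail p) <_) (*-comm (prodF (tail p)) (p zero))
        (m<m*n (prodF (tail p)) (p zero) {{>-nonZero (prodF-pos (tail p) (<⇒≤ ∘ 1<p ∘ suc))}} (1<p zero)))

module Rationals where

  open import Data.Nat.Base using (suc)
  open import Data.Integer.Base using (+_; -[1+_]; 0ℤ; 1ℤ; _+_; _*_; -_; _≤_; _<_; +<+)
  open import Data.Integer.Properties
    using (neg-mono-≤; neg-distribˡ-*; neg-distribʳ-*; ≤-reflexive; *-identityʳ; *-zeroˡ; *-comm)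
  open import Data.Rational.Base as ℚ using (↥_; ↧_; _/_)
  open import Data.Rational.Properties as ℚ using (toℚᵘ-cancel-≤; toℚᵘ-fromℚᵘ)
  import Data.Rational.Unnormalised.Base as ℚᵘ
  import Data.Rational.Unnormalised.Properties as ℚᵘ
  open import Relation.Binary.PropositionalEquality
  open import Defs using (M)

  ≤-/ : ∀ {α} i n → ↥ α * + suc n ≤ i * ↧ α → α ℚ.≤ i / suc n
  ≤-/ {α@record{}} i n α≤i/n =
    toℚᵘ-cancel-≤ (ℚᵘ.≤-respʳ-≃ (ℚᵘ.≃-sym (toℚᵘ-fromℚᵘ (ℚᵘ.mkℚᵘ i n))) (ℚᵘ.*≤* α≤i/n))

  /-≤ : ∀ {α} i n → i * ↧ α ≤ ↥ α * + suc n → i / suc n ℚ.≤ α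
  /-≤ {α@record{}} i n i/n≤α =
    toℚᵘ-cancel-≤ (ℚᵘ.≤-respˡ-≃ (ℚᵘ.≃-sym (toℚᵘ-fromℚᵘ (ℚᵘ.mkℚᵘ i n))) (ℚᵘ.*≤* i/n≤α))

  ↥≡↧*N⇒≡N : ∀ {α} N → ↥ α ≡ ↧ α * + N → α ≡ + N / 1
  ↥≡↧*N⇒≡N {α} N eq = ℚ.≤-antisym (≤-/ (+ N) 0 (≤-reflexive cross)) (/-≤ (+ N) 0 (≤-reflexive (sym cross)))
    where
    cross : ↥ α * + 1 ≡ + N * ↧ α
    cross = trans (*-identityʳ (↥ α)) (trans eq (*-comm (↧ α) (+ N)))

  <0⇒↥<0 : ∀ {α} → α ℚ.< ℚ.0ℚ → ↥ α < 0ℤ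
  <0⇒↥<0 {α} (ℚ.*<* α<0) = subst₂ _<_ (*-identityʳ (↥ α)) (*-zeroˡ (↧ α)) α<0

  ≤-M : ∀ {α} N k x → 0ℤ < k + 1ℤ → ↥ α * (k + 1ℤ) ≤ (+ N + k * + x) * ↧ α → α ℚ.≤ M N k x
  ≤-M N k x 0<k+1 α≤M with k + 1ℤ
  ... | + suc n = ≤-/ (+ N + k * + x) n α≤M
  ≤-M N k x (+<+ ()) α≤M | + 0

  M-≤ : ∀ {α} N k x → k + 1ℤ < 0ℤ → ↥ α * (k + 1ℤ) ≤ (+ N + k * + x) * ↧ α → M N k x ℚ.≤ α
  M-≤ {α} N k x k+1<0 α*[k+1]≤N+kx with k + 1ℤ
  ... | -[1+ n ] = /-≤ (- (+ N + k * + x)) n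
                     (subst₂ _≤_ (neg-distribˡ-* (+ N + k * + x) (↧ α)) (neg-distribʳ-* (↥ α) -[1+ n ])
                       (neg-mono-≤ α*[k+1]≤N+kx))
  M-≤ N k x (+<+ ()) α*[k+1]≤N+kx | + _

module KorseltQuotients where

  open import Data.Integer.Base
  open import Data.Integer.Properties
  open import Data.Integer.Tactic.RingSolver using (solve-∀)
  open import Data.Rational.Base as ℚ using (ℚ; ↥_; ↧_)
  open import Relation.Binary.PropositionalEquality
  open Integers

  record KorseltQuotient (N : ℤ) (α : ℚ) (x q : ℤ) : Set where
    constructor is-quotient
    field equation : q * (↧ α * x - ↥ α) ≡ ↧ α * N - ↥ α

  0<↧ : ∀ α → 0ℤ < ↧ α
  0<↧ α = +<+ (ℕ.s≤s ℕ.z≤n)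

  quotient-monoˡ : ∀ {N x α α′ q q′} → KorseltQuotient N α x q → KorseltQuotient N α′ x q′ →
                   x < N → α ℚ.< α′ → 0ℤ < (↧ α * x - ↥ α) * (↧ α′ * x - ↥ α′) → q < q′
  quotient-monoˡ {N} {x} {α} {α′} (is-quotient eq) (is-quotient eq′) x<N (ℚ.*<* α<α′) same-side =
    quotient-< eq eq′ same-side cross-<
    where
    cross : ∀ a b a′ b′ x N →
            (b′ * N - a′) * (b * x - a) ≡ (b * N - a) * (b′ * x - a′) + (N - x) * (a′ * b - a * b′)
    cross = solve-∀
    KD′ : ℤ
    KD′ = (↧ α * N - ↥ α) * (↧ α′ * x - ↥ α′)
    cross-< : KD′ < (↧ α′ * N - ↥ α′) * (↧ α * x - ↥ α)
    cross-< = subst (KD′ <_) (sym (cross (↥ α) (↧ α) (↥ α′) (↧ α′) x N))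
      (i<i+j KD′ (pos*pos⇒pos (i<j⇒0<j-i x<N) (i<j⇒0<j-i α<α′)))

  quotient-antitoneʳ : ∀ {N x y α q q′} → KorseltQuotient N α x q → KorseltQuotient N α y q′ →
                       x < y → ↥ α < ↧ α * N → 0ℤ < (↧ α * x - ↥ α) * (↧ α * y - ↥ α) → q′ < q
  quotient-antitoneʳ {N} {x} {y} {α} (is-quotient eq) (is-quotient eq′) x<y α<N same-side =
    quotient-< eq′ eq (subst (0ℤ <_) (*-comm (↧ α * x - ↥ α) (↧ α * y - ↥ α)) same-side) cross-<
    where
    cross : ∀ a b x y N →
            (b * N - a) * (b * y - a) ≡ (b * N - a) * (b * x - a) + (b * N - a) * (b * (y - x))
    cross = solve-∀
    KDx : ℤ
    KDx = (↧ α * N - ↥ α) * (↧ α * x - ↥ α)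
    cross-< : KDx < (↧ α * N - ↥ α) * (↧ α * y - ↥ α)
    cross-< = subst (KDx <_) (sym (cross (↥ α) (↧ α) x y N))
      (i<i+j KDx (pos*pos⇒pos (i<j⇒0<j-i α<N) (pos*pos⇒pos (0<↧ α) (i<j⇒0<j-i x<y))))

  above-monoˡ : ∀ {x α α′} → ↧ α * x < ↥ α → α ℚ.≤ α′ → ↧ α′ * x < ↥ α′
  above-monoˡ {x} {α} {α′} x<α (ℚ.*≤* α≤α′) =
    *-cancelʳ-<-nonNeg (↧ α) {{nonNegative (<⇒≤ (0<↧ α))}} (begin-strict
      ↧ α′ * x * ↧ α     ≡⟨ reassoc (↧ α′) x (↧ α) ⟩
      ↧ α′ * (↧ α * x)   <⟨ *-monoˡ-<-pos (↧ α′) {{positive (0<↧ α′)}} x<α ⟩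
      ↧ α′ * ↥ α         ≡⟨ *-comm (↧ α′) (↥ α) ⟩
      ↥ α * ↧ α′         ≤⟨ α≤α′ ⟩
      ↥ α′ * ↧ α         ∎)
    where
    open ≤-Reasoning
    reassoc : ∀ b′ x b → b′ * x * b ≡ b′ * (b * x)
    reassoc = solve-∀

  above-antitoneʳ : ∀ {x y} α → x ≤ y → ↧ α * y < ↥ α → ↧ α * x < ↥ α
  above-antitoneʳ α x≤y y<α = ≤-<-trans (*-monoˡ-≤-nonNeg (↧ α) {{nonNegative (<⇒≤ (0<↧ α))}} x≤y) y<α

  quotient⇒bound : ∀ {N x α q} k → KorseltQuotient N α x q → 0ℤ ≤ (q + k) * (↧ α * x - ↥ α) →
                   ↥ α * (k + 1ℤ) ≤ (N + k * x) * ↧ α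
  quotient⇒bound {N} {x} {α} {q} k (is-quotient eq) 0≤[q+k]D =
    subst (↥ α * (k + 1ℤ) ≤_) (sym split) (i≤i+j (↥ α * (k + 1ℤ)) ((q + k) * D) {{nonNegative 0≤[q+k]D}})
    where
    open ≡-Reasoning
    D : ℤ
    D = ↧ α * x - ↥ α
    rearrange : ∀ a b x N k → (N + k * x) * b ≡ a * (k + 1ℤ) + ((b * N - a) + k * (b * x - a))
    rearrange = solve-∀
    split : (N + k * x) * ↧ α ≡ ↥ α * (k + 1ℤ) + (q + k) * D
    split = begin
      (N + k * x) * ↧ α                           ≡⟨ rearrange (↥ α) (↧ α) x N k ⟩
      ↥ α * (k + 1ℤ) + ((↧ α * N - ↥ α) + k * D)  ≡⟨ cong (λ K → ↥ α * (k + 1ℤ) + (K + k * D)) (sym eq) ⟩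
      ↥ α * (k + 1ℤ) + (q * D + k * D)            ≡⟨ cong (λ t → ↥ α * (k + 1ℤ) + t) (sym (*-distribʳ-+ D q k)) ⟩
      ↥ α * (k + 1ℤ) + (q + k) * D                ∎

  below⇒bound : ∀ {N x} α k → ↥ α ≤ ↧ α * x → x ≤ N → 0ℤ ≤ k + 1ℤ →
                ↥ α * (k + 1ℤ) ≤ (N + k * x) * ↧ α
  below⇒bound {N} {x} α k α≤x x≤N 0≤k+1 =
    subst (↥ α * (k + 1ℤ) ≤_) (sym (rearrange (↥ α) (↧ α) x N k))
      (i≤i+j _ _ {{nonNegative (+-mono-≤ (nonNeg*nonNeg⇒nonNeg (<⇒≤ (0<↧ α)) (i≤j⇒0≤j-i x≤N))
                                           (nonNeg*nonNeg⇒nonNeg 0≤k+1 (i≤j⇒0≤j-i α≤x)))}})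
    where
    rearrange : ∀ a b x N k → (N + k * x) * b ≡ a * (k + 1ℤ) + (b * (N - x) + (k + 1ℤ) * (b * x - a))
    rearrange = solve-∀

  above⇒≤N : ∀ {N x α q} → KorseltQuotient N α x q → ↧ α * x < ↥ α → x < N → ↥ α ≤ ↧ α * N
  above⇒≤N {N} {x} {α} {q} (is-quotient eq) x<α x<N = ≮⇒≥ λ N<α →
    <⇒≱ (+-monoʳ-< (↥ α) (neg-mono-< bx<bN))
      (pos-quotient⇒≤ {q} negated (i<j⇒0<j-i x<α) (i<j⇒0<j-i N<α))
    where
    bx<bN : ↧ α * x < ↧ α * N
    bx<bN = *-monoˡ-<-pos (↧ α) {{positive (0<↧ α)}} x<N
    flip : ∀ q a b x → q * (a - b * x) ≡ - (q * (b * x - a))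
    flip = solve-∀
    negate : ∀ a b N → - (b * N - a) ≡ a - b * N
    negate = solve-∀
    negated : q * (↥ α - ↧ α * x) ≡ ↥ α - ↧ α * N
    negated = trans (flip q (↥ α) (↧ α) x) (trans (cong -_ eq) (negate (↥ α) (↧ α) N))

  above⇒quotient<0 : ∀ {N x α q} → KorseltQuotient N α x q → ↧ α * x < ↥ α → ↥ α < ↧ α * N → q < 0ℤ
  above⇒quotient<0 {N} {x} {α} {q} (is-quotient eq) x<α α<N =
    neg-cancel-< {0ℤ} {q} (pos-quotient (trans (flip q (↥ α) (↧ α) x) eq) (i<j⇒0<j-i x<α) (i<j⇒0<j-i α<N))
    where
    flip : ∀ q a b x → - q * (a - b * x) ≡ q * (b * x - a)
    flip = solve-∀

  below⇒quotient>1 : ∀ {N x α q} → KorseltQuotient N α x q → ↥ α < ↧ α * x → x < N → 1ℤ < q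
  below⇒quotient>1 {N} {x} {α} (is-quotient eq) α<x x<N =
    quotient>1 eq (i<j⇒0<j-i α<x) (+-monoˡ-< (- ↥ α) (*-monoˡ-<-pos (↧ α) {{positive (0<↧ α)}} x<N))

module LargestPrime where

  import Data.Nat.Properties as ℕ
  import Data.Nat.Divisibility as ℕ
  open import Data.Nat.Primality using (prime⇒irreducible; prime⇒nonZero; ¬prime[1])
  open import Data.Integer.Base
  open import Data.Integer.Properties
  open import Data.Integer.Divisibility.Signed using (_∣_; ∣m∣n⇒∣m-n; ∣m∣n⇒∣m+n; ∣-refl; *-cancelˡ-∣)
  open import Data.Integer.Tactic.RingSolver using (solve-∀)
  open import Data.Rational.Base using (↥_; ↧_)
  open import Data.Sum using ([_,_]′)
  open import Data.Empty using (⊥)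
  open import Relation.Binary.PropositionalEquality
  open Integers
  open KorseltQuotients

  2P<N<4P⇒N≡3P : ∀ {P N} → P ℕ.∣ N → 2 ℕ.* P ℕ.< N → N ℕ.< 4 ℕ.* P → N ≡ 3 ℕ.* P
  2P<N<4P⇒N≡3P {P} (ℕ.divides R refl) 2P<N N<4P =
    cong (ℕ._* P) (ℕ.≤-antisym (ℕ.s≤s⁻¹ (ℕ.*-cancelʳ-< P R 4 N<4P)) (ℕ.*-cancelʳ-< P 2 R 2P<N))

  prime≢3*prime : ∀ {P q} → Prime P → Prime q → P ≢ 3 ℕ.* q
  prime≢3*prime {P} {q} prP prq P≡3q =
    [ (λ q≡1 → ¬prime[1] (subst Prime q≡1 prq)) , q≢P ]′ (prime⇒irreducible prP (ℕ.divides 3 P≡3q))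
    where
    q≢P : q ≢ P
    q≢P q≡P with ℕ.*-cancelʳ-≡ 1 3 q {{prime⇒nonZero prq}} (trans (ℕ.*-identityˡ q) (trans q≡P P≡3q))
    ... | ()

  divisor∣⇒N≡3P : ∀ {N P q} → P ℕ.∣ N → 0ℤ < + N - (+ P + + P) → 0ℤ < + q → + q < + P →
                  (+ N - (+ P + + P) + + q) ∣ ((+ P - + q) + (+ P - + q)) → N ≡ 3 ℕ.* P
  divisor∣⇒N≡3P {N} {P} {q} P∣N 0<n-2p 0<s s<p D∣F =
    2P<N<4P⇒N≡3P P∣N (drop‿+<+ (subst (_< n) (sym (pos-* 2 P)) 2p<n)) (drop‿+<+ (subst (n <_) (sym (pos-* 4 P)) n<4p))
    where
    open ≤-Reasoning
    n = + N
    p = + P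
    s = + q
    D = n - (p + p) + s
    F = (p - s) + (p - s)
    0<F : 0ℤ < F
    0<F = +-mono-< (i<j⇒0<j-i s<p) (i<j⇒0<j-i s<p)
    D≤F : D ≤ F
    D≤F = pos-quotient⇒≤ {_∣_.quotient D∣F} (sym (_∣_.equality D∣F)) (+-mono-< 0<n-2p 0<s) 0<F
    shift-D : ∀ n p s → n + (s + s + s) ≡ (n - (p + p) + s) + ((p + p) + (s + s))
    shift-D = solve-∀
    shift-F : ∀ p s → ((p - s) + (p - s)) + ((p + p) + (s + s)) ≡ + 4 * p
    shift-F = solve-∀
    n<4p : n < + 4 * p
    n<4p = begin-strict
      n                              <⟨ i<i+j n (+-mono-< (+-mono-< 0<s 0<s) 0<s) ⟩
      n + (s + s + s)                ≡⟨ shift-D n p s ⟩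
      D + ((p + p) + (s + s))        ≤⟨ +-monoˡ-≤ ((p + p) + (s + s)) D≤F ⟩
      F + ((p + p) + (s + s))        ≡⟨ shift-F p s ⟩
      + 4 * p                        ∎
    shift-n : ∀ n p → + 2 * p + (n - (p + p)) ≡ n
    shift-n = solve-∀
    2p<n : + 2 * p < n
    2p<n = subst (+ 2 * p <_) (shift-n n p) (i<i+j (+ 2 * p) 0<n-2p)

  divisor∣⇒P≡3q : ∀ {P q} → 0ℤ < + q → + q < + P → (+ P + + q) ∣ ((+ P - + q) + (+ P - + q)) → P ≡ 3 ℕ.* q
  divisor∣⇒P≡3q {P} {q} 0<s s<p D∣F = +-injective (trans p≡3s (sym (pos-* 3 q)))
    where
    p = + P
    s = + q
    D = p + s
    F = (p - s) + (p - s)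
    0<F : 0ℤ < F
    0<F = +-mono-< (i<j⇒0<j-i s<p) (i<j⇒0<j-i s<p)
    0<4s : 0ℤ < s + s + s + s
    0<4s = +-mono-< (+-mono-< (+-mono-< 0<s 0<s) 0<s) 0<s
    double : ∀ p s → (p - s) + (p - s) + (s + s + s + s) ≡ (p + s) + (p + s)
    double = solve-∀
    F≡D : F ≡ 1ℤ * D
    F≡D = trans (_∣_.equality D∣F)
      (cong (_* D) (quotient≡1 {_∣_.quotient D∣F} (sym (_∣_.equality D∣F)) (+-mono-< (<-trans 0<s s<p) 0<s) 0<F
                     (subst (F <_) (double p s) (i<i+j F 0<4s))))
    excess : ∀ p s → p - + 3 * s ≡ ((p - s) + (p - s)) - 1ℤ * (p + s)
    excess = solve-∀
    p≡3s : p ≡ + 3 * s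
    p≡3s = i-j≡0⇒i≡j p (+ 3 * s) (trans (excess p s) (i≡j⇒i-j≡0 F≡D))

  -- A quotient 2 at P means β = 2P − N, so the Korselt condition at q reads
  -- (N − 2P + q) ∣ 2(P − q); this forces N = 3P and then P = 3q.
  korselt-quotient≢2 : ∀ {N P q β} → Prime P → Prime q → q ℕ.< P → P ℕ.∣ N → ↥ β < 0ℤ →
                       KorseltQuotient (+ N) β (+ P) (+ 2) → (↧ β * + q - ↥ β) ∣ (↧ β * + N - ↥ β) → ⊥
  korselt-quotient≢2 {N} {P} {q} {β} prP prq q<P P∣N β<0 (is-quotient eq) div =
    prime≢3*prime prP prq (divisor∣⇒P≡3q 0<s s<p (subst (_∣ F) D≡p+s (subst (λ M → (+ M - (p + p) + s) ∣ F) N≡3P D∣F)))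
    where
    open ≡-Reasoning
    n = + N
    p = + P
    s = + q
    a = ↥ β
    b = ↧ β
    D = n - (p + p) + s
    F = (p - s) + (p - s)
    0<s : 0ℤ < s
    0<s = +<+ (ℕ.>-nonZero⁻¹ q {{prime⇒nonZero prq}})
    s<p : s < p
    s<p = +<+ q<P
    eliminate : ∀ a b n p → a ≡ b * ((p + p) - n) + ((b * n - a) - + 2 * (b * p - a))
    eliminate = solve-∀
    cancel : ∀ x y → x + (y - y) ≡ x
    cancel = solve-∀
    a≡ : a ≡ b * ((p + p) - n)
    a≡ = begin
      a                                                       ≡⟨ eliminate a b n p ⟩
      b * ((p + p) - n) + ((b * n - a) - + 2 * (b * p - a))   ≡⟨ cong (λ K → b * ((p + p) - n) + (K - + 2 * (b * p - a))) (sym eq) ⟩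
      b * ((p + p) - n) + (+ 2 * (b * p - a) - + 2 * (b * p - a)) ≡⟨ cancel (b * ((p + p) - n)) (+ 2 * (b * p - a)) ⟩
      b * ((p + p) - n)                                       ∎
    negate : ∀ b n p → - (b * ((p + p) - n)) ≡ b * (n - (p + p))
    negate = solve-∀
    0<n-2p : 0ℤ < n - (p + p)
    0<n-2p = *-cancelˡ-<-nonNeg b
      (subst₂ _<_ (sym (*-zeroʳ b)) (trans (cong -_ a≡) (negate b n p)) (neg-mono-< β<0))
    divisor : ∀ b n p s → b * s - b * ((p + p) - n) ≡ b * (n - (p + p) + s)
    divisor = solve-∀
    remainder : ∀ b n p s → (b * n - b * ((p + p) - n)) - ((b * s - b * ((p + p) - n)) + (b * s - b * ((p + p) - n)))
                            ≡ b * ((p - s) + (p - s))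
    remainder = solve-∀
    D∣F : D ∣ F
    D∣F = *-cancelˡ-∣ b
      (subst₂ _∣_ (trans (cong (λ a → b * s - a) a≡) (divisor b n p s))
                  (trans (cong (λ a → (b * n - a) - ((b * s - a) + (b * s - a))) a≡) (remainder b n p s))
                  (∣m∣n⇒∣m-n div (∣m∣n⇒∣m+n ∣-refl ∣-refl)))
    N≡3P : N ≡ 3 ℕ.* P
    N≡3P = divisor∣⇒N≡3P P∣N 0<n-2p 0<s s<p D∣F
    at-3P : ∀ p s → + 3 * p - (p + p) + s ≡ p + s
    at-3P = solve-∀
    D≡p+s : + (3 ℕ.* P) - (p + p) + s ≡ p + s
    D≡p+s = trans (cong (λ t → t - (p + p) + s) (pos-* 3 P)) (at-3P p s)

module Bounds (m′ : ℕ) (p : Fin (2 ℕ.+ m′) → ℕ) (prime : ∀ j → Prime (p j))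
              (p-mono : ∀ i j → i Fin.< j → p i ℕ.< p j) where

  open import Data.Nat.Base as ℕ using (suc; _∸_; z≤n)
  import Data.Nat.Properties as ℕ
  import Data.Nat.Tactic.RingSolver as ℕ-Solver
  open import Data.Nat.Primality using (prime⇒nonZero; prime⇒nonTrivial)
  open import Data.Integer.Base hiding (suc; _/_)
  open import Data.Integer.Properties
  open import Data.Integer.Divisibility.Signed using (_∣_; ∣ᵤ⇒∣)
  open import Data.Rational.Base as ℚ using (ℚ; ↥_; ↧_; 0ℚ)
  import Data.Rational.Properties as ℚ
  open import Data.Fin.Base as Fin using (toℕ; fromℕ)
  open import Data.Fin.Properties using (toℕ-fromℕ; ≤fromℕ)
  open import Data.Product using (_×_; ∃; _,_; proj₁; proj₂)
  open import Function.Bundles using (_⇔_; Equivalence)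
  open import Data.Sum using ([_,_]′)
  open import Relation.Binary.PropositionalEquality
  open import Relation.Nullary using (yes; no)
  open import Defs using (prodF; QKS; M)
  open Integers
  open KorseltQuotients
  open Rationals
  open LargestPrime
  open FinGaps
  open Products

  N : ℕ
  N = prodF p

  p<N : ∀ j → + p j < + N
  p<N j = +<+ (factor<prodF p (λ j → ℕ.nonTrivial⇒n>1 (p j) {{prime⇒nonTrivial (prime j)}}) j)

  0<p : ∀ j → 0ℤ < + p j
  0<p j = +<+ (ℕ.>-nonZero⁻¹ (p j) {{prime⇒nonZero (prime j)}})

  p-≤ : ∀ {k j} → k Fin.≤ j → p k ℕ.≤ p j
  p-≤ k≤j = [ (λ k≡j → ℕ.≤-reflexive (cong p k≡j)) , (λ k<j → ℕ.<⇒≤ (p-mono _ _ k<j)) ]′ (≤⇒≡∨< k≤j)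

  korselt-divisibility : ∀ {α} → QKS N α → ∀ j → (↧ α * + p j - ↥ α) ∣ (↧ α * + N - ↥ α)
  korselt-divisibility korselt j = ∣ᵤ⇒∣ (proj₂ (proj₂ korselt) (p j) (prime j) (factor∣prodF p j))

  korselt-quotient : ∀ {α} → QKS N α → Fin (2 ℕ.+ m′) → ℤ
  korselt-quotient korselt j = _∣_.quotient (korselt-divisibility korselt j)

  korselt-quotient-spec : ∀ {α} (korselt : QKS N α) j → KorseltQuotient (+ N) α (+ p j) (korselt-quotient korselt j)
  korselt-quotient-spec korselt j = is-quotient (sym (_∣_.equality (korselt-divisibility korselt j)))

  module PositiveElements (r′ : ℕ) (γ : Fin (suc r′) → ℚ) (γ-mono : ∀ i i′ → i Fin.< i′ → γ i ℚ.< γ i′)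
                  (γ-korselt : ∀ i → QKS N (γ i)) where

    q : Fin (suc r′) → Fin (2 ℕ.+ m′) → ℤ
    q i = korselt-quotient (γ-korselt i)

    q-spec : ∀ i j → KorseltQuotient (+ N) (γ i) (+ p j) (q i j)
    q-spec i = korselt-quotient-spec (γ-korselt i)

    p_<γ_ : Fin (2 ℕ.+ m′) → Fin (suc r′) → Set
    p j <γ i = ↧ (γ i) * + p j < ↥ (γ i)

    γ-≤ : ∀ {i k} → i Fin.≤ k → γ i ℚ.≤ γ k
    γ-≤ i≤k = [ (λ i≡k → ℚ.≤-reflexive (cong γ i≡k)) , (λ i<k → ℚ.<⇒≤ (γ-mono _ _ i<k)) ]′ (≤⇒≡∨< i≤k)

    γ<N : ∀ {i j} → p j <γ i → ↥ (γ i) < ↧ (γ i) * + N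
    γ<N {i} {j} p<γ = ≤∧≢⇒< (above⇒≤N (q-spec i j) p<γ (p<N j))
                             (λ eq → proj₁ (proj₂ (γ-korselt i)) (↥≡↧*N⇒≡N N eq))

    same-side : ∀ {k l j j′} → p j <γ k → p j′ <γ l →
                0ℤ < (↧ (γ k) * + p j - ↥ (γ k)) * (↧ (γ l) * + p j′ - ↥ (γ l))
    same-side p<γ p′<γ = neg*neg⇒pos (i<j⇒i-j<0 p<γ) (i<j⇒i-j<0 p′<γ)

    last : Fin (suc r′)
    last = fromℕ r′

    ascend-γ : ∀ {i j} → p j <γ i → q i j + + (toℕ last ∸ toℕ i) ≤ q last j
    ascend-γ {i} {j} p<γ = gap-ascending (λ k → q k j) (≤fromℕ i) λ {k} {l} i≤k k<l _ →
      quotient-monoˡ (q-spec k j) (q-spec l j) (p<N j) (γ-mono k l k<l)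
        (same-side (above-monoˡ p<γ (γ-≤ i≤k)) (above-monoˡ p<γ (γ-≤ (ℕ.<⇒≤ (ℕ.≤-<-trans i≤k k<l)))))

    descend-p : ∀ {j} → p j <γ last → q last j + + toℕ j ≤ q last Fin.zero
    descend-p {j} p<γ = gap-descending (q last) {Fin.zero} {j} z≤n λ {k} {l} _ k<l l≤j →
      quotient-antitoneʳ (q-spec last k) (q-spec last l) (+<+ (p-mono k l k<l)) (γ<N p<γ)
        (same-side (above-antitoneʳ (γ last) (+≤+ (p-≤ (ℕ.<⇒≤ (ℕ.<-≤-trans k<l l≤j)))) p<γ)
                   (above-antitoneʳ (γ last) (+≤+ (p-≤ l≤j)) p<γ))

    exponent : Fin (suc r′) → Fin (2 ℕ.+ m′) → ℤ
    exponent i j = + (toℕ j ℕ.+ suc r′) - + toℕ i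

    exponent≡ : ∀ i j → exponent i j ≡ + suc ((toℕ last ∸ toℕ i) ℕ.+ toℕ j)
    exponent≡ i j = begin
      + (toℕ j ℕ.+ suc r′) - + toℕ i              ≡⟨ cong (λ n → + (toℕ j ℕ.+ suc n) - + toℕ i) (sym i+d≡r′) ⟩
      + (toℕ j ℕ.+ suc (toℕ i ℕ.+ d)) - + toℕ i   ≡⟨ cong (λ n → + n - + toℕ i) (regroup (toℕ j) (toℕ i) d) ⟩
      + (suc (d ℕ.+ toℕ j) ℕ.+ toℕ i) - + toℕ i   ≡⟨ +[m+n]-+n≡+m (suc (d ℕ.+ toℕ j)) (toℕ i) ⟩
      + suc (d ℕ.+ toℕ j)                         ∎
      where
      open ≡-Reasoning
      d = toℕ last ∸ toℕ i
      i+d≡r′ : toℕ i ℕ.+ d ≡ r′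
      i+d≡r′ = trans (ℕ.m+[n∸m]≡n (≤fromℕ i)) (toℕ-fromℕ r′)
      regroup : ∀ j i d → j ℕ.+ suc (i ℕ.+ d) ≡ suc (d ℕ.+ j) ℕ.+ i
      regroup = ℕ-Solver.solve-∀

    0<exponent+1 : ∀ i j → 0ℤ < exponent i j + 1ℤ
    0<exponent+1 i j = subst (λ k → 0ℤ < k + 1ℤ) (sym (exponent≡ i j)) (+<+ (ℕ.s≤s z≤n))

    bound-below : ∀ {i j} → ↥ (γ i) ≤ ↧ (γ i) * + p j → γ i ℚ.≤ M N (exponent i j) (p j)
    bound-below {i} {j} γ≤p = ≤-M N (exponent i j) (p j) (0<exponent+1 i j)
      (below⇒bound (γ i) (exponent i j) γ≤p (<⇒≤ (p<N j)) (<⇒≤ (0<exponent+1 i j)))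

    bound-above : ∀ {i j} → p j <γ i → γ i ℚ.≤ M N (exponent i j) (p j)
    bound-above {i} {j} p<γ = ≤-M N (exponent i j) (p j) (0<exponent+1 i j)
      (quotient⇒bound (exponent i j) (q-spec i j) (nonPos*nonPos⇒nonNeg q+k≤0 (<⇒≤ (i<j⇒i-j<0 p<γ))))
      where
      p<γ-last : p j <γ last
      p<γ-last = above-monoˡ p<γ (γ-≤ (≤fromℕ i))
      q-last<0 : q last Fin.zero < 0ℤ
      q-last<0 = above⇒quotient<0 (q-spec last Fin.zero) (above-antitoneʳ (γ last) (+≤+ (p-≤ z≤n)) p<γ-last) (γ<N p<γ-last)
      q+k≤0 : q i j + exponent i j ≤ 0ℤ
      q+k≤0 = subst (λ k → q i j + k ≤ 0ℤ) (sym (exponent≡ i j))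
        (≤-chain-<0 {q i j} (toℕ last ∸ toℕ i) (toℕ j) (ascend-γ p<γ) (descend-p p<γ-last) q-last<0)

    bound : ∀ i j → γ i ℚ.≤ M N (exponent i j) (p j)
    bound i j with ↥ (γ i) ≤? ↧ (γ i) * + p j
    ... | yes γ≤p = bound-below γ≤p
    ... | no  γ≰p = bound-above (≰⇒> γ≰p)

  module NegativeElements (t′ : ℕ) (β : Fin (suc t′) → ℚ) (β-mono : ∀ s s′ → s Fin.< s′ → β s ℚ.< β s′)
                          (β-korselt : ∀ s → QKS N (β s)) (β<0 : ∀ s → ↥ (β s) < 0ℤ) where

    q : Fin (suc t′) → Fin (2 ℕ.+ m′) → ℤ
    q s = korselt-quotient (β-korselt s)

    q-spec : ∀ s j → KorseltQuotient (+ N) (β s) (+ p j) (q s j)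
    q-spec s = korselt-quotient-spec (β-korselt s)

    β<p : ∀ s j → ↥ (β s) < ↧ (β s) * + p j
    β<p s j = <-trans (β<0 s) (pos*pos⇒pos (0<↧ (β s)) (0<p j))

    same-side : ∀ s s′ j j′ → 0ℤ < (↧ (β s) * + p j - ↥ (β s)) * (↧ (β s′) * + p j′ - ↥ (β s′))
    same-side s s′ j j′ = pos*pos⇒pos (i<j⇒0<j-i (β<p s j)) (i<j⇒0<j-i (β<p s′ j′))

    largest : Fin (2 ℕ.+ m′)
    largest = fromℕ (suc m′)

    ascend-β : ∀ s j → q Fin.zero j + + toℕ s ≤ q s j
    ascend-β s j = gap-ascending (λ s → q s j) {Fin.zero} {s} z≤n λ {k} {l} _ k<l _ →
      quotient-monoˡ (q-spec k j) (q-spec l j) (p<N j) (β-mono k l k<l) (same-side k l j j)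

    descend-p : ∀ j → q Fin.zero largest + + (toℕ largest ∸ toℕ j) ≤ q Fin.zero j
    descend-p j = gap-descending (q Fin.zero) (≤fromℕ j) λ {k} {l} _ k<l _ →
      quotient-antitoneʳ (q-spec Fin.zero k) (q-spec Fin.zero l) (+<+ (p-mono k l k<l))
        (<-trans (β<0 Fin.zero) (pos*pos⇒pos (0<↧ (β Fin.zero)) (<-trans (0<p j) (p<N j))))
        (same-side Fin.zero Fin.zero k l)

    q-largest>2 : + 2 < q Fin.zero largest
    q-largest>2 = ≤∧≢⇒< (i<j⇒suc[i]≤j (below⇒quotient>1 (q-spec Fin.zero largest) (β<p Fin.zero largest) (p<N largest)))
      λ 2≡q → korselt-quotient≢2 (prime largest) (prime Fin.zero) (p-mono Fin.zero largest (ℕ.s≤s z≤n))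
                (factor∣prodF p largest) (β<0 Fin.zero)
                (subst (KorseltQuotient (+ N) (β Fin.zero) (+ p largest)) (sym 2≡q) (q-spec Fin.zero largest))
                (korselt-divisibility (β-korselt Fin.zero) Fin.zero)

    exponent : Fin (suc t′) → Fin (2 ℕ.+ m′) → ℤ
    exponent s j = + toℕ j - + (2 ℕ.+ m′ ℕ.+ toℕ s ℕ.+ 2)

    exponent≡ : ∀ s j → exponent s j ≡ - + (3 ℕ.+ (toℕ s ℕ.+ (toℕ largest ∸ toℕ j)))
    exponent≡ s j = begin
      + toℕ j - + (suc (suc m′) ℕ.+ toℕ s ℕ.+ 2)          ≡⟨ cong (λ n → + toℕ j - + (suc n ℕ.+ toℕ s ℕ.+ 2)) (sym j+d≡1+m′) ⟩
      + toℕ j - + (suc (toℕ j ℕ.+ d) ℕ.+ toℕ s ℕ.+ 2)     ≡⟨ cong (λ n → + toℕ j - + n) (regroup (toℕ j) d (toℕ s)) ⟩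
      + toℕ j - + (toℕ j ℕ.+ (3 ℕ.+ (toℕ s ℕ.+ d)))       ≡⟨ +m-+[m+n]≡-+n (toℕ j) (3 ℕ.+ (toℕ s ℕ.+ d)) ⟩
      - + (3 ℕ.+ (toℕ s ℕ.+ d))                           ∎
      where
      open ≡-Reasoning
      d = toℕ largest ∸ toℕ j
      j+d≡1+m′ : toℕ j ℕ.+ d ≡ suc m′
      j+d≡1+m′ = trans (ℕ.m+[n∸m]≡n (≤fromℕ j)) (toℕ-fromℕ (suc m′))
      regroup : ∀ j d s → suc (j ℕ.+ d) ℕ.+ s ℕ.+ 2 ≡ j ℕ.+ (3 ℕ.+ (s ℕ.+ d))
      regroup = ℕ-Solver.solve-∀

    exponent+1<0 : ∀ s j → exponent s j + 1ℤ < 0ℤ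
    exponent+1<0 s j = subst (λ k → k + 1ℤ < 0ℤ) (sym (exponent≡ s j)) -<+

    bound : ∀ s j → M N (exponent s j) (p j) ℚ.≤ β s
    bound s j = M-≤ N (exponent s j) (p j) (exponent+1<0 s j)
      (quotient⇒bound (exponent s j) (q-spec s j) (nonNeg*nonNeg⇒nonNeg 0≤q+k (<⇒≤ (i<j⇒0<j-i (β<p s j)))))
      where
      0≤q+k : 0ℤ ≤ q s j + exponent s j
      0≤q+k = subst (λ k → 0ℤ ≤ q s j + k) (sym (exponent≡ s j))
        (≤-chain->2 {q s j} (toℕ s) (toℕ largest ∸ toℕ j) (descend-p j) (ascend-β s j) q-largest>2)

  positive-bounds : (r : ℕ) (γ : Fin r → ℚ) → (∀ i i′ → i Fin.< i′ → γ i ℚ.< γ i′) →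
                    (∀ α → (QKS N α × 0ℚ ℚ.< α) ⇔ ∃ (λ i → γ i ≡ α)) →
                    ∀ i j → γ i ℚ.≤ M N (+ (toℕ j ℕ.+ r) - + toℕ i) (p j)
  positive-bounds (suc r′) γ γ-mono γ-iff =
    PositiveElements.bound r′ γ γ-mono λ i → proj₁ (Equivalence.from (γ-iff (γ i)) (i , refl))

  negative-bounds : (t : ℕ) (β : Fin t → ℚ) → (∀ s s′ → s Fin.< s′ → β s ℚ.< β s′) →
                    (∀ α → (QKS N α × α ℚ.< 0ℚ) ⇔ ∃ (λ s → β s ≡ α)) →
                    ∀ s j → M N (+ toℕ j - + (2 ℕ.+ m′ ℕ.+ toℕ s ℕ.+ 2)) (p j) ℚ.≤ β s
  negative-bounds (suc t′) β β-mono β-iff =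
    NegativeElements.bound t′ β β-mono (λ s → proj₁ (from s)) (λ s → <0⇒↥<0 (proj₂ (from s)))
    where
    from : ∀ s → QKS N (β s) × β s ℚ.< 0ℚ
    from s = Equivalence.from (β-iff (β s)) (s , refl)

open import Defs
open import Data.Nat as ℕ using (ℕ; _≤_)
open import Data.Nat.Primality using (Prime)
open import Data.Integer as ℤ using (+_)
open import Data.Rational as ℚ using (ℚ; 0ℚ)
open import Data.Fin as Fin using (Fin; toℕ)
open import Data.Product using (_×_; ∃)
open import Function.Bundles using (_⇔_)
open import Relation.Binary.PropositionalEquality using (_≡_)
open import Data.Product using (_,_)

proposition2p3 :
  (m : ℕ) → 2 ≤ m →
  (p : Fin m → ℕ) → (∀ j → Prime (p j)) → (∀ i j → i Fin.< j → p i ℕ.< p j) →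
  ((r : ℕ) (γ : Fin r → ℚ) → (∀ i i′ → i Fin.< i′ → γ i ℚ.< γ i′) →
    (∀ α → (QKS (prodF p) α × 0ℚ ℚ.< α) ⇔ ∃ (λ i → γ i ≡ α)) →
    ∀ i j → γ i ℚ.≤ M (prodF p) (+ (toℕ j ℕ.+ r) ℤ.- + toℕ i) (p j))
  ×
  ((t : ℕ) (β : Fin t → ℚ) → (∀ s s′ → s Fin.< s′ → β s ℚ.< β s′) →
    (∀ α → (QKS (prodF p) α × α ℚ.< 0ℚ) ⇔ ∃ (λ s → β s ≡ α)) →
    ∀ s j → M (prodF p) (+ toℕ j ℤ.- + (m ℕ.+ toℕ s ℕ.+ 2)) (p j) ℚ.≤ β s)
proposition2p3 (ℕ.suc (ℕ.suc m′)) _ p prime p-mono = positive-bounds , negative-bounds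
  where
  open Bounds m′ p prime p-mono
proposition2p3 (ℕ.suc ℕ.zero) (ℕ.s≤s ())
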